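{- Let $k \geq 1$ and let $n, j \geq 2$ be integers. Then $p^k(n,j) \leq p^k(n+1,j+1)$, with equality whenever $n < 2^k j$.
   Context: $p^k(n,j)$ denotes the number of partitions of $n$ into exactly $j$ parts, each part a positive $k$-th power (unordered); i.e., the number of ways to write $n$ as a sum of exactly $j$ positive $k$-th powers, up to order of summands. -}

module Defs where

open import Data.Nat using (ℕ; zero; suc; _+_; _^_; _≟_)
open import Data.List using (List; []; _∷_; map; concatMap; filter; length; upTo)
open import Data.Nat.ListAction using (sum)
open import Relation.Nullary.Decidable using (does)

-- Weakly decreasing lists of exactly j entries, each entry in {1, …, b}.
-- These are exactly the multisets of size j of elements of {1,…,b},
-- each listed once (in non-increasing order).
decLists : ℕ → ℕ → List (List ℕ)
decLists zero    b = [] ∷ []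
decLists (suc j) b =
  concatMap (λ i → map (λ xs → suc i ∷ xs) (decLists j (suc i))) (upTo b)

powSum : ℕ → List ℕ → ℕ
powSum k xs = sum (map (λ x → x ^ k) xs)

-- Bases are bounded by n (x ≥ 1, k ≥ 1 and x^k ≤ n
-- force x ≤ n), so enumerating multisets of bases from {1,…,n} suffices.
-- (For k = 0 every base gives 1; the statement assumes k ≥ 1.)
p : ℕ → ℕ → ℕ → ℕ
p k n j = length (filter (λ xs → powSum k xs ≟ n) (decLists j n))

{-# OPTIONS --safe #-}

-- Appending a part 1 = 1 ^ k maps partitions of n into j k-th powers injectively to
-- partitions of n + 1 into j + 1 of them.  A partition missed by this map has all j + 1
-- parts at least 2 ^ k, so it can only exist when n + 1 ≥ 2 ^ k * (j + 1); hence the map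
-- is onto when n < 2 ^ k * j.  Both facts are proved on counts, by induction along the
-- recurrence that separates partitions according to whether they use the largest
-- allowed base.

module Submission where

open import Defs
open import Data.Bool using (true; false)
open import Data.List using (List; []; _∷_; _++_; _∷ʳ_; [_]; map; concat; concatMap; filter; length; upTo)
open import Data.List.Properties using (length-++; filter-++; filter-none; filter-≐; map-++; concat-++; concat-[_]; upTo-∷ʳ)
open import Data.List.Relation.Unary.All using (universal)
open import Data.Nat using (ℕ; zero; suc; z≤n; s≤s; _≤_; _<_; _*_; _^_; _+_; _≟_)
open import Data.Nat.Properties
open import Data.Product using (_×_; _,_)
open import Function using (_∘_)
open import Level using (Level)
open import Relation.Binary.PropositionalEquality using (_≡_; refl; sym; trans; cong; cong₂; subst; module ≡-Reasoning)
open import Relation.Nullary.Decidable using (does)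
open import Relation.Unary using (Pred; Decidable)

private
  variable
    ℓ ℓ₁ ℓ₂ : Level
    A : Set ℓ₁
    B : Set ℓ₂

module _ {P : Pred A ℓ} (P? : Decidable P) where

  length-filter-++ : ∀ xs ys →
    length (filter P? (xs ++ ys)) ≡ length (filter P? xs) + length (filter P? ys)
  length-filter-++ xs ys = trans (cong length (filter-++ P? xs ys)) (length-++ (filter P? xs))

  length-filter-map : (f : B → A) → ∀ xs →
    length (filter P? (map f xs)) ≡ length (filter (P? ∘ f) xs)
  length-filter-map f [] = refl
  length-filter-map f (x ∷ xs) with does (P? (f x))
  ... | true  = cong suc (length-filter-map f xs)
  ... | false = length-filter-map f xs

concatMap-∷ʳ : (g : A → List B) → ∀ xs x → concatMap g (xs ∷ʳ x) ≡ concatMap g xs ++ g x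
concatMap-∷ʳ g xs x = begin
  concat (map g (xs ++ [ x ]))      ≡⟨ cong concat (map-++ g xs [ x ]) ⟩
  concat (map g xs ++ [ g x ])      ≡⟨ concat-++ (map g xs) [ g x ] ⟨
  concatMap g xs ++ concat [ g x ]  ≡⟨ cong (concatMap g xs ++_) concat-[ g x ] ⟩
  concatMap g xs ++ g x             ∎
  where open ≡-Reasoning

module _ (k : ℕ) where

  -- ways j b a n counts the partitions of n ∸ a into j k-th powers of bases at most b.
  -- The offset a keeps the recursion free of truncated subtraction, and p k n j is
  -- ways k j n 0 n by definition.
  ways : (j b a n : ℕ) → ℕ
  ways j b a n = length (filter (λ xs → a + powSum k xs ≟ n) (decLists j b))

  ways-shift : ∀ j b a n → ways j b (suc a) (suc n) ≡ ways j b a n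
  ways-shift j b a n = cong length (filter-≐ _ _ (suc-injective , cong suc) (decLists j b))

  ways-suc-bound : ∀ j b a n →
    ways (suc j) (suc b) a n ≡ ways (suc j) b a n + ways j (suc b) (a + suc b ^ k) n
  ways-suc-bound j b a n = begin
    count (concatMap g (upTo (suc b)))           ≡⟨ cong (count ∘ concatMap g) (upTo-∷ʳ b) ⟨
    count (concatMap g (upTo b ∷ʳ b))            ≡⟨ cong count (concatMap-∷ʳ g (upTo b) b) ⟩
    count (concatMap g (upTo b) ++ g b)          ≡⟨ length-filter-++ P? (concatMap g (upTo b)) (g b) ⟩
    ways (suc j) b a n + count (g b)             ≡⟨ cong (ways (suc j) b a n +_) count-top ⟩
    ways (suc j) b a n + ways j (suc b) (a + suc b ^ k) n ∎
    where
    open ≡-Reasoning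
    P? = λ xs → a + powSum k xs ≟ n
    count = λ xss → length (filter P? xss)
    g = λ i → map (suc i ∷_) (decLists j (suc i))
    count-top : count (g b) ≡ ways j (suc b) (a + suc b ^ k) n
    count-top = trans (length-filter-map P? (suc b ∷_) (decLists j (suc b)))
      (cong length (filter-≐ (P? ∘ (suc b ∷_)) (λ xs → a + suc b ^ k + powSum k xs ≟ n)
        ((λ {xs} → trans (+-assoc a (suc b ^ k) (powSum k xs)))
        , (λ {xs} → trans (sym (+-assoc a (suc b ^ k) (powSum k xs)))))
        (decLists j (suc b))))

  ways-below : ∀ j b a n → n < a → ways j b a n ≡ 0
  ways-below j b a n n<a = cong length (filter-none (λ xs → a + powSum k xs ≟ n)
    (universal (λ xs eq → <⇒≱ n<a (subst (a ≤_) eq (m≤m+n a (powSum k xs)))) (decLists j b)))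

  ways-suc-below : ∀ j b a n → n ≤ a → ways (suc j) b a n ≡ 0
  ways-suc-below j zero    a n n≤a = refl
  ways-suc-below j (suc b) a n n≤a = begin
    ways (suc j) (suc b) a n                              ≡⟨ ways-suc-bound j b a n ⟩
    ways (suc j) b a n + ways j (suc b) (a + suc b ^ k) n ≡⟨ cong₂ _+_ (ways-suc-below j b a n n≤a)
                                                               (ways-below j (suc b) _ n n<a+top) ⟩
    0                                                     ∎
    where
    open ≡-Reasoning
    n<a+top : n < a + suc b ^ k
    n<a+top = ≤-<-trans n≤a (m<m+n a (m^n>0 (suc b) k))

  ways-bound-one : ∀ j a n → ways (suc j) 1 a (suc n) ≡ ways j 1 a n
  ways-bound-one j a n = begin
    ways (suc j) 1 a (suc n)         ≡⟨ ways-suc-bound j 0 a (suc n) ⟩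
    ways j 1 (a + 1 ^ k) (suc n)     ≡⟨ cong (λ c → ways j 1 c (suc n)) a+1^k≡1+a ⟩
    ways j 1 (suc a) (suc n)         ≡⟨ ways-shift j 1 a n ⟩
    ways j 1 a n                     ∎
    where
    open ≡-Reasoning
    a+1^k≡1+a : a + 1 ^ k ≡ suc a
    a+1^k≡1+a = trans (cong (a +_) (^-zeroˡ k)) (+-comm a 1)

  ways-≤-ways-suc : ∀ j b a n → ways j (suc b) a n ≤ ways (suc j) (suc b) a (suc n)
  ways-≤-ways-suc j       zero    a n = ≤-reflexive (sym (ways-bound-one j a n))
  ways-≤-ways-suc zero    (suc b) a n = begin
    ways 0 (suc b) a n                                   ≤⟨ ways-≤-ways-suc zero b a n ⟩
    ways 1 (suc b) a (suc n)                             ≤⟨ m≤m+n _ _ ⟩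
    ways 1 (suc b) a (suc n) + ways 0 (2 + b) a′ (suc n) ≡⟨ ways-suc-bound 0 (suc b) a (suc n) ⟨
    ways 1 (2 + b) a (suc n)                             ∎
    where
    open ≤-Reasoning
    a′ = a + (2 + b) ^ k
  ways-≤-ways-suc (suc j) (suc b) a n = begin
    ways (suc j) (2 + b) a n                            ≡⟨ ways-suc-bound j (suc b) a n ⟩
    ways (suc j) (suc b) a n + ways j (2 + b) a′ n      ≤⟨ +-mono-≤ (ways-≤-ways-suc (suc j) b a n)
                                                                     (ways-≤-ways-suc j (suc b) a′ n) ⟩
    ways (2 + j) (suc b) a (suc n) + ways (suc j) (2 + b) a′ (suc n)
                                                        ≡⟨ ways-suc-bound (suc j) (suc b) a (suc n) ⟨
    ways (2 + j) (2 + b) a (suc n)                      ∎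
    where
    open ≤-Reasoning
    a′ = a + (2 + b) ^ k

  a+2^k*[1+j]≤a+[2+b]^k+2^k*j : ∀ a b j → a + 2 ^ k * suc j ≤ a + (2 + b) ^ k + 2 ^ k * j
  a+2^k*[1+j]≤a+[2+b]^k+2^k*j a b j = begin
    a + 2 ^ k * suc j              ≡⟨ cong (a +_) (*-suc (2 ^ k) j) ⟩
    a + (2 ^ k + 2 ^ k * j)        ≤⟨ +-monoʳ-≤ a (+-monoˡ-≤ (2 ^ k * j) (^-monoˡ-≤ k (s≤s (s≤s z≤n)))) ⟩
    a + ((2 + b) ^ k + 2 ^ k * j)  ≡⟨ +-assoc a _ _ ⟨
    a + (2 + b) ^ k + 2 ^ k * j    ∎
    where open ≤-Reasoning

  ways-≡-ways-suc : ∀ j b a n → n < a + 2 ^ k * j →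
    ways j (suc b) a n ≡ ways (suc j) (suc b) a (suc n)
  ways-≡-ways-suc zero    b       a n h =
    trans (ways-below 0 (suc b) a n n<a) (sym (ways-suc-below 0 (suc b) a (suc n) n<a))
    where
    n<a : n < a
    n<a = subst (n <_) (trans (cong (a +_) (*-zeroʳ (2 ^ k))) (+-identityʳ a)) h
  ways-≡-ways-suc (suc j) zero    a n h = sym (ways-bound-one (suc j) a n)
  ways-≡-ways-suc (suc j) (suc b) a n h = begin
    ways (suc j) (2 + b) a n                            ≡⟨ ways-suc-bound j (suc b) a n ⟩
    ways (suc j) (suc b) a n + ways j (2 + b) a′ n      ≡⟨ cong₂ _+_ (ways-≡-ways-suc (suc j) b a n h)
                                                                     (ways-≡-ways-suc j (suc b) a′ n h′) ⟩
    ways (2 + j) (suc b) a (suc n) + ways (suc j) (2 + b) a′ (suc n)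
                                                        ≡⟨ ways-suc-bound (suc j) (suc b) a (suc n) ⟨
    ways (2 + j) (2 + b) a (suc n)                      ∎
    where
    open ≡-Reasoning
    a′ = a + (2 + b) ^ k
    h′ : n < a′ + 2 ^ k * j
    h′ = <-≤-trans h (a+2^k*[1+j]≤a+[2+b]^k+2^k*j a b j)

  ways-bound-redundant : ∀ j b a n → n ≤ a + suc b ^ k →
    ways (2 + j) b a n ≡ ways (2 + j) (suc b) a n
  ways-bound-redundant j b a n h = sym (begin
    ways (2 + j) (suc b) a n                                    ≡⟨ ways-suc-bound (suc j) b a n ⟩
    ways (2 + j) b a n + ways (suc j) (suc b) (a + suc b ^ k) n ≡⟨ cong (ways (2 + j) b a n +_)
                                                                     (ways-suc-below j (suc b) _ n h) ⟩
    ways (2 + j) b a n + 0                                      ≡⟨ +-identityʳ _ ⟩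
    ways (2 + j) b a n                                          ∎)
    where open ≡-Reasoning

theorem2p2 : (k n j : ℕ) → 1 ≤ k → 2 ≤ n → 2 ≤ j →
    (p k n j ≤ p k (n + 1) (j + 1))
    × (n < 2 ^ k * j → p k n j ≡ p k (n + 1) (j + 1))
theorem2p2 k (suc n) (suc j) 1≤k (s≤s _) (s≤s _) rewrite +-comm n 1 | +-comm j 1 =
    ≤-trans (ways-≤-ways-suc k (suc j) n 0 (suc n)) (≤-reflexive drop-largest)
  , λ h → trans (ways-≡-ways-suc k (suc j) n 0 (suc n) h) drop-largest
  where
  2+n≤[2+n]^k : 2 + n ≤ (2 + n) ^ k
  2+n≤[2+n]^k = subst (_≤ (2 + n) ^ k) (^-identityʳ (2 + n)) (^-monoʳ-≤ (2 + n) 1≤k)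
  drop-largest : ways k (2 + j) (suc n) 0 (2 + n) ≡ ways k (2 + j) (2 + n) 0 (2 + n)
  drop-largest = ways-bound-redundant k j (suc n) 0 (2 + n) 2+n≤[2+n]^k
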